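{- Assume the following statement $(\ast)$ holds: for every odd, square-free positive integer $n$ divisible by $3$ such that there exists $p\in\{5,7,13\}$ with $p\mid n$ and $r\nmid n$ for every $r\in\{5,7,13\}\setminus\{p\}$, and such that there exists $q\in T(3p)\setminus\{5,7,13\}$ with $q\nmid n$, one has $t(n)\geq 4$. If $n$ is a positive integer with $3\mid n$, then $t(n)\geq 3$.
   Context: For an integer $n$, a Toda prime of $n$ is an odd prime $p$ such that $p-1\mid 4n$ and $\gcd\!\left(p,\frac{4n}{p-1}\right)=1$. $T(n)$ denotes the set of Toda primes of $n$, and $t(n):=|T(n)|$. -}

module Defs where

open import Data.Nat using (ℕ; zero; suc; _+_; _*_; _∸_; _/_; _≤_; _<_)
open import Data.Nat.Properties using (_≟_)
open import Data.Nat.Divisibility using (_∣_; _∣?_)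
open import Data.Nat.GCD using (gcd)
open import Data.Nat.Primality using (Prime; prime?)
open import Data.List using (List; filter; upTo; length)
open import Data.Product using (_×_; Σ-syntax)
open import Data.Sum using (_⊎_)
open import Data.Empty using (⊥)
open import Relation.Nullary using (¬_; Dec)
open import Relation.Nullary.Decidable using (_×-dec_; ¬?)
open import Relation.Binary.PropositionalEquality using (_≡_; _≢_)

-- m / d, with the convention m / 0 = 0 (only used when d ≥ 1).
quot : ℕ → ℕ → ℕ
quot m zero    = 0
quot m (suc d) = m / suc d

IsTodaPrime : ℕ → ℕ → Set
IsTodaPrime n p =
  Prime p × ¬ (2 ∣ p) × ((p ∸ 1) ∣ 4 * n) × (gcd p (quot (4 * n) (p ∸ 1)) ≡ 1)

isTodaPrime? : (n p : ℕ) → Dec (IsTodaPrime n p)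
isTodaPrime? n p =
  prime? p ×-dec (¬? (2 ∣? p) ×-dec (((p ∸ 1) ∣? (4 * n)) ×-dec (gcd p (quot (4 * n) (p ∸ 1)) ≟ 1)))

-- T(n) as a list: every Toda prime p of n satisfies p ≤ 4n + 1 (as p - 1 ∣ 4n,
-- and T(0) = ∅), so filtering [0, 4n+1] enumerates T(n) exactly once each.
T : ℕ → List ℕ
T n = filter (isTodaPrime? n) (upTo (4 * n + 2))

t : ℕ → ℕ
t n = length (T n)

InS : ℕ → Set
InS p = p ≡ 5 ⊎ p ≡ 7 ⊎ p ≡ 13

SquareFree : ℕ → Set
SquareFree n = ∀ q → Prime q → ¬ (q * q ∣ n)

Condition : ℕ → ℕ → Set
Condition n p =
  InS p × p ∣ n × (∀ r → InS r → r ≢ p → ¬ (r ∣ n))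
  × Σ[ q ∈ ℕ ] (IsTodaPrime (3 * p) q × ¬ InS q × ¬ (q ∣ n))

Star : Set
Star = ∀ n → 0 < n → ¬ (2 ∣ n) → SquareFree n → 3 ∣ n →
       Σ[ p ∈ ℕ ] Condition n p → 4 ≤ t n

{-# OPTIONS --safe #-}
-- Dividing n by 2 or by a repeated prime factor cannot create Toda primes, so it suffices to
-- treat n odd, squarefree and divisible by 3, by strong induction on n. Let S = {5, 7, 13}; for
-- p ∈ S, p − 1 ∣ 12 ∣ 4n. If no element of S divides n, all three are Toda primes of n. If exactly
-- one p ∈ S does, (∗) applies with q = 11, 29, 53 ∈ T(3p): to n if q ∤ n, and otherwise to n/q,
-- whose Toda primes other than q are Toda primes of n. If two elements of S divide n, pick one, s,
-- and let v be the third; T(n/s) has an element a ∉ {s, v}, which is a Toda prime of n outside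
-- {3} ∪ S. Then a − 1 ∤ 12, so some prime z ≠ 3 divides both a − 1 and n. Now a ∉ T(n/z), as
-- z ∣ a − 1 ∣ 4n/z would give z² ∣ n, so T(n) contains a and the two or more elements of
-- T(n/z) ∖ {z}.
module Submission where

open import Defs
open import Data.Nat using (ℕ; zero; suc; _+_; _*_; _∸_; _≤_; _<_; s≤s; s≤s⁻¹; >-nonZero; >-nonZero⁻¹; nonTrivial⇒n>1)
open import Data.Nat.Properties
open import Data.Nat.Divisibility
open import Data.Nat.DivMod using (m/n*n≡m)
open import Data.Nat.GCD using (gcd; gcd[m,n]∣m; gcd[m,n]∣n; gcd-greatest; c*gcd[m,n]≡gcd[cm,cn]; gcd[m,n]≢0)
open import Data.Nat.Primality using (Prime; prime?; euclidsLemma; prime⇒irreducible; prime⇒nonTrivial; ¬prime[0]; ¬prime[1]; prime[2])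
open import Data.Nat.Primality.Factorisation using (factorise)
open import Data.Nat.ListAction using (product)
open import Data.Nat.Induction using (<-rec)
import Data.Fin as Fin
open import Data.Fin.Properties using (injective⇒≤)
open import Data.List using (List; []; _∷_; length; lookup; upTo)
open import Data.List.Membership.Propositional using (_∈_; _∉_; find; lose)
open import Data.List.Membership.Propositional.Properties using (∈-filter⁺; ∈-filter⁻; ∈-upTo⁺; ∈-lookup)
open import Data.List.Membership.Setoid.Properties using (index-injective)
open import Data.List.Relation.Binary.Subset.Propositional using (_⊆_)
open import Data.List.Relation.Unary.All as All using (All; []; _∷_)
open import Data.List.Relation.Unary.All.Properties using (¬Any⇒All¬)
open import Data.List.Relation.Unary.Any using (here; there; any?)
open import Data.List.Relation.Unary.AllPairs using ([]; _∷_)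
open import Data.List.Relation.Unary.Unique.Propositional using (Unique)
open import Data.List.Relation.Unary.Unique.Propositional.Properties using (filter⁺; upTo⁺)
open import Data.Product using (_×_; _,_; proj₂; Σ-syntax; ∃-syntax)
open import Data.Sum using (_⊎_; inj₁; inj₂)
open import Function using (_∘_; const)
open import Relation.Binary.Definitions using (DecidableEquality)
open import Relation.Binary.PropositionalEquality using (_≡_; _≢_; refl; sym; trans; cong; subst; ≢-sym; setoid)
open import Relation.Nullary using (¬_; yes; no; contradiction)
open import Relation.Nullary.Decidable using (Dec; ¬?; decidable-stable; from-yes; from-no; _×-dec_; _⊎-dec_; _→-dec_)

private variable
  a d g m n p q r s v z : ℕ

prime⇒>1 : Prime p → 1 < p
prime⇒>1 {p} pp = nonTrivial⇒n>1 p {{prime⇒nonTrivial pp}}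

prime[3] : Prime 3
prime[3] = from-yes (prime? 3)

prime⇒≢1 : Prime p → p ≢ 1
prime⇒≢1 pp refl = ¬prime[1] pp

prime-∣prime⇒≡ : Prime p → Prime q → p ∣ q → p ≡ q
prime-∣prime⇒≡ pp pq p∣q with prime⇒irreducible pq p∣q
... | inj₁ p≡1 = contradiction p≡1 (prime⇒≢1 pp)
... | inj₂ p≡q = p≡q

prime∣m*prime⇒∣m : Prime p → Prime r → p ≢ r → p ∣ m * r → p ∣ m
prime∣m*prime⇒∣m {r = r} {m = m} pp pr p≢r p∣m*r with euclidsLemma m r pp p∣m*r
... | inj₁ p∣m = p∣m
... | inj₂ p∣r = contradiction (prime-∣prime⇒≡ pp pr p∣r) p≢r

0<m*n⇒0<m : 0 < m * n → 0 < m
0<m*n⇒0<m {m} 0<m*n = >-nonZero⁻¹ m {{m*n≢0⇒m≢0 m {{>-nonZero 0<m*n}}}}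

odd⇒≢2 : ¬ 2 ∣ p → p ≢ 2
odd⇒≢2 2∤p refl = 2∤p ∣-refl

odd-prime∣4*n⇒∣n : Prime p → ¬ 2 ∣ p → p ∣ 4 * n → p ∣ n
odd-prime∣4*n⇒∣n {p} {n} pp 2∤p p∣4n =
  prime∣m*prime⇒∣m pp prime[2] (odd⇒≢2 2∤p) (prime∣m*prime⇒∣m pp prime[2] (odd⇒≢2 2∤p)
    (subst (p ∣_) (trans (*-comm 4 n) (sym (*-assoc n 2 2))) p∣4n))

prime∤pred : Prime p → ¬ p ∣ p ∸ 1
prime∤pred {zero}        pp _   = ¬prime[0] pp
prime∤pred {suc zero}    pp _   = ¬prime[1] pp
prime∤pred {suc (suc k)} _  p∣pred = <-irrefl refl (∣⇒≤ p∣pred)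

gcd≡1⇒∤ : Prime p → gcd p m ≡ 1 → ¬ p ∣ m
gcd≡1⇒∤ pp gcd≡1 p∣m = prime⇒≢1 pp (∣1⇒≡1 (subst (_ ∣_) gcd≡1 (gcd-greatest ∣-refl p∣m)))

∤⇒gcd≡1 : Prime p → ¬ p ∣ m → gcd p m ≡ 1
∤⇒gcd≡1 {p} {m} pp p∤m with prime⇒irreducible pp (gcd[m,n]∣m p m)
... | inj₁ gcd≡1 = gcd≡1
... | inj₂ gcd≡p = contradiction (subst (_∣ m) gcd≡p (gcd[m,n]∣n p m)) p∤m

prime-factor : 1 < n → ∃[ p ] Prime p × p ∣ n
prime-factor {n} 1<n with factorise n {{>-nonZero (<⇒≤ 1<n)}}
... | record { factors = [] ; isFactorisation = n≡1 } = contradiction n≡1 (≢-sym (<⇒≢ 1<n))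
... | record { factors = p ∷ ps ; isFactorisation = n≡p*ps ; factorsPrime = pp ∷ _ } =
  p , pp , divides (product ps) (trans n≡p*ps (*-comm p (product ps)))

squarefree-∣ : m ∣ n → SquareFree n → SquareFree m
squarefree-∣ m∣n sf q pq q²∣m = sf q pq (∣-trans q²∣m m∣n)

squarefree⇒∤quotient : Prime r → SquareFree (m * r) → ¬ r ∣ m
squarefree⇒∤quotient {r} pr sf r∣m = sf r pr (*-monoˡ-∣ r r∣m)

prime-factor-≢ : Prime q → 0 < g → SquareFree g → ¬ g ∣ q → ∃[ z ] Prime z × z ≢ q × z ∣ g
prime-factor-≢ {q} {g} pq 0<g sf g∤q with q ∣? g
... | no q∤g =
  let z , pz , z∣g = prime-factor (≤∧≢⇒< 0<g λ { refl → g∤q (1∣ q) })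
  in  z , pz , (λ z≡q → q∤g (subst (_∣ g) z≡q z∣g)) , z∣g
... | yes (divides j refl) =
  let z , pz , z∣j = prime-factor (≤∧≢⇒< (0<m*n⇒0<m 0<g) λ { refl → g∤q (∣-reflexive (*-identityˡ q)) })
  in  z , pz , (λ z≡q → sf q pq (*-monoˡ-∣ q (subst (_∣ j) z≡q z∣j))) , ∣m⇒∣m*n q z∣j

squarefree-or-square-factor : 0 < n → SquareFree n ⊎ ∃[ q ] ∃[ m ] Prime q × q ∣ m × n ≡ m * q
squarefree-or-square-factor {n} 0<n with anyUpTo? (λ q → prime? q ×-dec q * q ∣? n) (suc n)
... | yes (q , _ , pq , divides j refl) = inj₂ (q , j * q , pq , n∣m*n j , sym (*-assoc j q q))
... | no ∄ = inj₁ λ q pq q²∣n → ∄ (q , s≤s (∣⇒≤ {{>-nonZero 0<n}} (m*n∣⇒m∣ q q q²∣n)) , pq , q²∣n)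

module _ {ℓ} {A : Set ℓ} where

  unique-lookup-injective : ∀ {xs : List A} → Unique xs → ∀ i j → lookup xs i ≡ lookup xs j → i ≡ j
  unique-lookup-injective (_    ∷ _)   Fin.zero    Fin.zero    _  = refl
  unique-lookup-injective (x≢xs ∷ _)   Fin.zero    (Fin.suc j) eq =
    contradiction eq (All.lookup x≢xs (∈-lookup j))
  unique-lookup-injective (x≢xs ∷ _)   (Fin.suc i) Fin.zero    eq =
    contradiction (sym eq) (All.lookup x≢xs (∈-lookup i))
  unique-lookup-injective (_    ∷ uxs) (Fin.suc i) (Fin.suc j) eq =
    cong Fin.suc (unique-lookup-injective uxs i j eq)

  unique∧⊆⇒length≤ : ∀ {xs ys : List A} → Unique xs → xs ⊆ ys → length xs ≤ length ys
  unique∧⊆⇒length≤ uxs xs⊆ys = injective⇒≤ λ {i} {j} eq →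
    unique-lookup-injective uxs i j (index-injective (setoid A) (xs⊆ys (∈-lookup i)) (xs⊆ys (∈-lookup j)) eq)

  module _ (_≟_ : DecidableEquality A) where
    open import Data.List.Membership.DecPropositional _≟_ using (_∈?_)

    unique∧length>⇒∃∉ : ∀ {xs ys : List A} → Unique xs → length ys < length xs → ∃[ x ] x ∈ xs × x ∉ ys
    unique∧length>⇒∃∉ {xs} {ys} uxs ys<xs with any? (λ x → ¬? (x ∈? ys)) xs
    ... | yes ∃∉ = find ∃∉
    ... | no ∄∉ = contradiction (unique∧⊆⇒length≤ uxs xs⊆ys) (<⇒≱ ys<xs)
      where xs⊆ys : xs ⊆ ys
            xs⊆ys {x} x∈xs = decidable-stable (x ∈? ys) (∄∉ ∘ lose x∈xs)

-- IsTodaPrime with the gcd condition replaced by the equivalent p ∤ n: since p ∤ p − 1, p divides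
-- 4n/(p − 1) iff it divides 4n.
record TodaPrime (n p : ℕ) : Set where
  constructor todaPrime
  field
    prime   : Prime p
    odd     : ¬ 2 ∣ p
    pred∣4n : p ∸ 1 ∣ 4 * n
    ∤n      : ¬ p ∣ n

quot*divisor≡ : d ∣ m → quot m d * d ≡ m
quot*divisor≡ {zero}  0∣m = sym (0∣⇒≡0 0∣m)
quot*divisor≡ {suc d} d∣m = m/n*n≡m d∣m

module _ (pp : Prime p) (pred∣4n : p ∸ 1 ∣ 4 * n) where

  private
    4n≡quot*pred : 4 * n ≡ quot (4 * n) (p ∸ 1) * (p ∸ 1)
    4n≡quot*pred = sym (quot*divisor≡ pred∣4n)

  ∣quot⇒∣ : ¬ 2 ∣ p → p ∣ quot (4 * n) (p ∸ 1) → p ∣ n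
  ∣quot⇒∣ 2∤p p∣quot =
    odd-prime∣4*n⇒∣n pp 2∤p (subst (p ∣_) (sym 4n≡quot*pred) (∣m⇒∣m*n (p ∸ 1) p∣quot))

  ∣⇒∣quot : p ∣ n → p ∣ quot (4 * n) (p ∸ 1)
  ∣⇒∣quot p∣n with euclidsLemma _ (p ∸ 1) pp (subst (p ∣_) 4n≡quot*pred (∣n⇒∣m*n 4 p∣n))
  ... | inj₁ p∣quot = p∣quot
  ... | inj₂ p∣pred = contradiction p∣pred (prime∤pred pp)

isTodaPrime⇒todaPrime : IsTodaPrime n p → TodaPrime n p
isTodaPrime⇒todaPrime (pp , 2∤p , pred∣4n , gcd≡1) =
  todaPrime pp 2∤p pred∣4n (gcd≡1⇒∤ pp gcd≡1 ∘ ∣⇒∣quot pp pred∣4n)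

todaPrime⇒isTodaPrime : TodaPrime n p → IsTodaPrime n p
todaPrime⇒isTodaPrime (todaPrime pp 2∤p pred∣4n p∤n) =
  pp , 2∤p , pred∣4n , ∤⇒gcd≡1 pp (p∤n ∘ ∣quot⇒∣ pp pred∣4n 2∤p)

todaPrime⇒∈T : 0 < n → TodaPrime n p → p ∈ T n
todaPrime⇒∈T {n} {p} 0<n tp@(todaPrime _ _ pred∣4n _) =
  ∈-filter⁺ (isTodaPrime? n) (∈-upTo⁺ p<4n+2) (todaPrime⇒isTodaPrime tp)
  where
  p<4n+2 : p < 4 * n + 2
  p<4n+2 = begin-strict
    p               ≤⟨ m≤n+m∸n p 1 ⟩
    1 + (p ∸ 1)     ≤⟨ +-monoʳ-≤ 1 (∣⇒≤ {{>-nonZero (*-monoʳ-< 4 0<n)}} pred∣4n) ⟩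
    1 + 4 * n       ≡⟨ +-comm 1 (4 * n) ⟩
    4 * n + 1       <⟨ +-monoʳ-< (4 * n) ≤-refl ⟩
    4 * n + 2       ∎
    where open ≤-Reasoning

∈T⇒todaPrime : ∀ n → p ∈ T n → TodaPrime n p
∈T⇒todaPrime n p∈Tn =
  isTodaPrime⇒todaPrime (proj₂ (∈-filter⁻ (isTodaPrime? n) {xs = upTo (4 * n + 2)} p∈Tn))

T-unique : ∀ n → Unique (T n)
T-unique n = filter⁺ (isTodaPrime? n) (upTo⁺ (4 * n + 2))

todaPrime-transfer : m ∣ n → (p ∣ n → p ∣ m) → TodaPrime m p → TodaPrime n p
todaPrime-transfer m∣n ∣n⇒∣m (todaPrime pp 2∤p pred∣4m p∤m) =
  todaPrime pp 2∤p (∣-trans pred∣4m (*-monoʳ-∣ 4 m∣n)) (p∤m ∘ ∣n⇒∣m)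

T-mono : 0 < n → m ∣ n → (∀ {p} → Prime p → ¬ 2 ∣ p → p ∣ n → p ∣ m) → T m ⊆ T n
T-mono {m = m} 0<n m∣n oddPrime∣n⇒∣m {p} p∈Tm = todaPrime⇒∈T 0<n
  (todaPrime-transfer m∣n (oddPrime∣n⇒∣m (TodaPrime.prime tp) (TodaPrime.odd tp)) tp)
  where
  tp : TodaPrime m p
  tp = ∈T⇒todaPrime m p∈Tm

t-mono : 0 < n → m ∣ n → (∀ {p} → Prime p → ¬ 2 ∣ p → p ∣ n → p ∣ m) → t m ≤ t n
t-mono {m = m} 0<n m∣n oddPrime∣n⇒∣m =
  unique∧⊆⇒length≤ (T-unique m) (T-mono {m = m} 0<n m∣n oddPrime∣n⇒∣m)

todaPrime-quotient : Prime r → p ≢ r → TodaPrime m p → TodaPrime (m * r) p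
todaPrime-quotient {r} pr p≢r tp =
  todaPrime-transfer (m∣m*n r) (prime∣m*prime⇒∣m (TodaPrime.prime tp) pr p≢r) tp

T-quotient-⊆ : 0 < m * r → Prime r → T m ⊆ r ∷ T (m * r)
T-quotient-⊆ {m} {r} 0<n pr {p} p∈Tm with p ≟ r
... | yes p≡r = here p≡r
... | no  p≢r = there (todaPrime⇒∈T 0<n (todaPrime-quotient pr p≢r (∈T⇒todaPrime m p∈Tm)))

t-quotient-≤ : 0 < m * r → Prime r → t m ≤ suc (t (m * r))
t-quotient-≤ {m} 0<n pr = unique∧⊆⇒length≤ (T-unique m) (T-quotient-⊆ {m = m} 0<n pr)

InS? : ∀ p → Dec (InS p)
InS? p = p ≟ 5 ⊎-dec p ≟ 7 ⊎-dec p ≟ 13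

pattern 5∈S  = inj₁ refl
pattern 7∈S  = inj₂ (inj₁ refl)
pattern 13∈S = inj₂ (inj₂ refl)

InS-elim : ∀ {ℓ} {P : ℕ → Set ℓ} → P 5 → P 7 → P 13 → ∀ p → InS p → P p
InS-elim P5 _  _   _ 5∈S  = P5
InS-elim _  P7 _   _ 7∈S  = P7
InS-elim _  _  P13 _ 13∈S = P13

InS⇒prime : InS p → Prime p
InS⇒prime {p} = InS-elim {P = Prime} (from-yes (prime? 5)) (from-yes (prime? 7)) (from-yes (prime? 13)) p

InS⇒≢3 : InS p → p ≢ 3
InS⇒≢3 {p} = InS-elim {P = λ p → p ≢ 3} (λ ()) (λ ()) (λ ()) p

InS⇒todaPrime : InS p → 3 ∣ n → ¬ p ∣ n → TodaPrime n p
InS⇒todaPrime {p} {n} p∈S 3∣n =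
  todaPrime (InS⇒prime p∈S) (odd p∈S) (∣-trans (pred∣12 p∈S) (*-monoʳ-∣ 4 3∣n))
  where
  odd : InS p → ¬ 2 ∣ p
  odd = InS-elim {P = λ p → ¬ 2 ∣ p} (from-no (2 ∣? 5)) (from-no (2 ∣? 7)) (from-no (2 ∣? 13)) p
  pred∣12 : InS p → p ∸ 1 ∣ 12
  pred∣12 = InS-elim {P = λ p → p ∸ 1 ∣ 12} (from-yes (4 ∣? 12)) (from-yes (6 ∣? 12)) (from-yes (12 ∣? 12)) p

odd-pred∣12 : ¬ 2 ∣ p → p ∸ 1 ∣ 12 → p ≡ 3 ⊎ InS p
odd-pred∣12 {p} 2∤p pred∣12 = checkedBelow14 p<14 2∤p pred∣12
  where
  checkedBelow14 : ∀ {p} → p < 14 → ¬ 2 ∣ p → p ∸ 1 ∣ 12 → p ≡ 3 ⊎ InS p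
  checkedBelow14 = from-yes (allUpTo? (λ p → ¬? (2 ∣? p) →-dec p ∸ 1 ∣? 12 →-dec (p ≟ 3 ⊎-dec InS? p)) 14)
  p<14 : p < 14
  p<14 = s≤s (≤-trans (m≤n+m∸n p 1) (+-monoʳ-≤ 1 (∣⇒≤ pred∣12)))

companion : InS p → ∃[ q ] IsTodaPrime (3 * p) q × ¬ InS q
companion {p} = InS-elim {P = λ p → ∃[ q ] IsTodaPrime (3 * p) q × ¬ InS q}
                     (11 , from-yes (isTodaPrime? 15 11) , from-no (InS? 11))
                     (29 , from-yes (isTodaPrime? 21 29) , from-no (InS? 29))
                     (53 , from-yes (isTodaPrime? 39 53) , from-no (InS? 53)) p

record Reduced (n : ℕ) : Set where
  constructor reduced
  field
    positive   : 0 < n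
    odd        : ¬ 2 ∣ n
    squarefree : SquareFree n
    3∣n        : 3 ∣ n

Reduced-quotient : Prime r → r ≢ 3 → Reduced (m * r) → Reduced m
Reduced-quotient {r} {m} pr r≢3 (reduced 0<n 2∤n sf 3∣n) = reduced
  (0<m*n⇒0<m 0<n)
  (2∤n ∘ ∣m⇒∣m*n r)
  (squarefree-∣ (m∣m*n r) sf)
  (prime∣m*prime⇒∣m prime[3] pr (≢-sym r≢3) 3∣n)

m<m*prime : 0 < m → Prime r → m < m * r
m<m*prime {m} {r} 0<m pr = m<m*n m r {{>-nonZero 0<m}} (prime⇒>1 pr)

common-odd-prime-factor : Reduced n → d ∣ 4 * n → ¬ d ∣ 12 → ∃[ z ] Prime z × z ≢ 3 × z ∣ n × z ∣ d
common-odd-prime-factor {n} {d} (reduced 0<n _ sf _) d∣4n d∤12 =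
  let z , pz , z≢3 , z∣gcd = prime-factor-≢ prime[3] 0<gcd (squarefree-∣ (gcd[m,n]∣n d n) sf) gcd∤3
  in  z , pz , z≢3 , ∣-trans z∣gcd (gcd[m,n]∣n d n) , ∣-trans z∣gcd (gcd[m,n]∣m d n)
  where
  d∣4*gcd : d ∣ 4 * gcd d n
  d∣4*gcd = subst (d ∣_) (sym (c*gcd[m,n]≡gcd[cm,cn] 4 d n)) (gcd-greatest (n∣m*n 4) d∣4n)
  gcd∤3 : ¬ gcd d n ∣ 3
  gcd∤3 gcd∣3 = d∤12 (∣-trans d∣4*gcd (*-monoʳ-∣ 4 gcd∣3))
  0<gcd : 0 < gcd d n
  0<gcd = n≢0⇒n>0 (gcd[m,n]≢0 d n (inj₂ (≢-sym (<⇒≢ 0<n))))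

odd-prime∣quotient : Prime r → (¬ 2 ∣ r → r ∣ m) → Prime p → ¬ 2 ∣ p → p ∣ m * r → p ∣ m
odd-prime∣quotient {r = r} {p = p} pr r-redundant pp 2∤p p∣m*r with p ≟ r
... | yes refl = r-redundant 2∤p
... | no  p≢r  = prime∣m*prime⇒∣m pp pr p≢r p∣m*r

-- ¬ 2 ∣ r → r ∣ m covers both r = 2 and r² ∣ n.
reduced-or-redundant-factor : 0 < n → 3 ∣ n →
  Reduced n ⊎ ∃[ r ] ∃[ m ] Prime r × (¬ 2 ∣ r → r ∣ m) × n ≡ m * r
reduced-or-redundant-factor {n} 0<n 3∣n with 2 ∣? n | squarefree-or-square-factor 0<n
... | no 2∤n                | inj₁ sf                          = inj₁ (reduced 0<n 2∤n sf 3∣n)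
... | yes (divides m n≡m*2) | _                                =
  inj₂ (2 , m , prime[2] , contradiction ∣-refl , n≡m*2)
... | no _                  | inj₂ (q , m , pq , q∣m , n≡m*q) = inj₂ (q , m , pq , const q∣m , n≡m*q)

star⇒4≤t : Star → Reduced n → Σ[ p ∈ ℕ ] Condition n p → 4 ≤ t n
star⇒4≤t star (reduced 0<n 2∤n sf 3∣n) = star _ 0<n 2∤n sf 3∣n

HoldsBelow : ℕ → Set
HoldsBelow n = ∀ {m} → m < n → Reduced m → 3 ≤ t m

none-in-S : Reduced n → ¬ 5 ∣ n → ¬ 7 ∣ n → ¬ 13 ∣ n → 3 ≤ t n
none-in-S {n} (reduced 0<n _ _ 3∣n) 5∤n 7∤n 13∤n = unique∧⊆⇒length≤ distinct S⊆Tn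
  where
  distinct : Unique (5 ∷ 7 ∷ 13 ∷ [])
  distinct = ((λ ()) ∷ (λ ()) ∷ []) ∷ ((λ ()) ∷ []) ∷ [] ∷ []
  ∈T : ∀ {p} → InS p → ¬ p ∣ n → p ∈ T n
  ∈T p∈S p∤n = todaPrime⇒∈T 0<n (InS⇒todaPrime p∈S 3∣n p∤n)
  S⊆Tn : 5 ∷ 7 ∷ 13 ∷ [] ⊆ T n
  S⊆Tn = All.lookup {P = _∈ T n} (∈T 5∈S 5∤n ∷ ∈T 7∈S 7∤n ∷ ∈T 13∈S 13∤n ∷ [])

exactly-one-in-S : Star → Reduced n → InS p → p ∣ n → (∀ r → InS r → r ≢ p → ¬ r ∣ n) → 3 ≤ t n
exactly-one-in-S {n} {p} star R p∈S p∣n others with companion p∈S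
... | q , q∈T[3p] , q∉S with q ∣? n
...   | no q∤n = ≤-trans (n≤1+n 3) (star⇒4≤t star R (p , p∈S , p∣n , others , q , q∈T[3p] , q∉S , q∤n))
...   | yes (divides m refl) =
  s≤s⁻¹ (≤-trans (star⇒4≤t star R′ (p , p∈S , p∣m , others′ , q , q∈T[3p] , q∉S , q∤m))
                 (t-quotient-≤ {m = m} (Reduced.positive R) pq))
  where
  tq : TodaPrime (3 * p) q
  tq = isTodaPrime⇒todaPrime q∈T[3p]
  pq : Prime q
  pq = TodaPrime.prime tq
  q≢3 : q ≢ 3
  q≢3 refl = TodaPrime.∤n tq (m∣m*n p)
  p≢q : p ≢ q
  p≢q refl = q∉S p∈S
  R′ : Reduced m
  R′ = Reduced-quotient pq q≢3 R
  p∣m : p ∣ m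
  p∣m = prime∣m*prime⇒∣m (InS⇒prime p∈S) pq p≢q p∣n
  others′ : ∀ r → InS r → r ≢ p → ¬ r ∣ m
  others′ r r∈S r≢p r∣m = others r r∈S r≢p (∣m⇒∣m*n q r∣m)
  q∤m : ¬ q ∣ m
  q∤m = squarefree⇒∤quotient pq (Reduced.squarefree R)

todaPrime-sharing-factor⇒3≤t : HoldsBelow n → Reduced n → TodaPrime n a →
                               Prime z → z ≢ 3 → z ∣ n → z ∣ a ∸ 1 → 3 ≤ t n
todaPrime-sharing-factor⇒3≤t {a = a} {z = z} ih R ta pz z≢3 (divides m refl) z∣pred =
  s≤s⁻¹ (≤-trans (s≤s (ih (m<m*prime (Reduced.positive R′) pz) R′))
                 (unique∧⊆⇒length≤ (a∉Tm ∷ T-unique m) a∷Tm⊆z∷Tn))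
  where
  R′ : Reduced m
  R′ = Reduced-quotient {m = m} pz z≢3 R
  z-odd : ¬ 2 ∣ z
  z-odd 2∣z = Reduced.odd R (subst (_∣ m * z) (sym (prime-∣prime⇒≡ prime[2] pz 2∣z)) (n∣m*n m))
  a∉Tm : All (a ≢_) (T m)
  a∉Tm = ¬Any⇒All¬ (T m) λ a∈Tm → squarefree⇒∤quotient {m = m} pz (Reduced.squarefree R)
    (odd-prime∣4*n⇒∣n pz z-odd (∣-trans z∣pred (TodaPrime.pred∣4n (∈T⇒todaPrime m a∈Tm))))
  a∷Tm⊆z∷Tn : a ∷ T m ⊆ z ∷ T (m * z)
  a∷Tm⊆z∷Tn (here refl)   = there (todaPrime⇒∈T (Reduced.positive R) ta)
  a∷Tm⊆z∷Tn (there x∈Tm) = T-quotient-⊆ {m = m} (Reduced.positive R) pz x∈Tm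

large-todaPrime⇒3≤t : HoldsBelow n → Reduced n → TodaPrime n a → ¬ a ∸ 1 ∣ 12 → 3 ≤ t n
large-todaPrime⇒3≤t ih R ta pred∤12 =
  let z , pz , z≢3 , z∣n , z∣pred = common-odd-prime-factor R (TodaPrime.pred∣4n ta) pred∤12
  in  todaPrime-sharing-factor⇒3≤t ih R ta pz z≢3 z∣n z∣pred

todaPrime≢v⇒pred∤12 : Reduced n → (∀ r → InS r → r ≢ v → r ∣ n) → TodaPrime n a → a ≢ v → ¬ a ∸ 1 ∣ 12
todaPrime≢v⇒pred∤12 {a = a} R covered ta a≢v pred∣12 with odd-pred∣12 (TodaPrime.odd ta) pred∣12
... | inj₁ refl = TodaPrime.∤n ta (Reduced.3∣n R)
... | inj₂ a∈S = TodaPrime.∤n ta (covered a a∈S a≢v)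

at-least-two-in-S : HoldsBelow n → Reduced n → InS s → s ≢ v → (∀ r → InS r → r ≢ v → r ∣ n) → 3 ≤ t n
at-least-two-in-S {s = s} {v = v} ih R s∈S s≢v covered with covered s s∈S s≢v
... | divides m refl =
  let a , a∈Tm , a∉[s,v] = unique∧length>⇒∃∉ _≟_ {ys = s ∷ v ∷ []} (T-unique m)
                             (ih (m<m*prime (Reduced.positive R′) ps) R′)
      ta = todaPrime-quotient ps (a∉[s,v] ∘ here) (∈T⇒todaPrime m a∈Tm)
  in  large-todaPrime⇒3≤t ih R ta (todaPrime≢v⇒pred∤12 R covered ta (a∉[s,v] ∘ there ∘ here))
  where
  ps : Prime s
  ps = InS⇒prime s∈S
  R′ : Reduced m
  R′ = Reduced-quotient ps (InS⇒≢3 s∈S) R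

reduced⇒3≤t : Star → Reduced n → 3 ≤ t n
reduced⇒3≤t {n} star = <-rec (λ n → Reduced n → 3 ≤ t n) step n
  where
  step : ∀ n → HoldsBelow n → Reduced n → 3 ≤ t n
  step n ih R with 5 ∣? n | 7 ∣? n | 13 ∣? n
  ... | no 5∤n  | no 7∤n  | no 13∤n  = none-in-S R 5∤n 7∤n 13∤n
  ... | yes 5∣n | no 7∤n  | no 13∤n  =
    exactly-one-in-S star R 5∈S 5∣n (InS-elim (contradiction refl) (const 7∤n) (const 13∤n))
  ... | no 5∤n  | yes 7∣n | no 13∤n  =
    exactly-one-in-S star R 7∈S 7∣n (InS-elim (const 5∤n) (contradiction refl) (const 13∤n))
  ... | no 5∤n  | no 7∤n  | yes 13∣n =
    exactly-one-in-S star R 13∈S 13∣n (InS-elim (const 5∤n) (const 7∤n) (contradiction refl))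
  ... | yes 5∣n | yes 7∣n | _        =
    at-least-two-in-S ih R 5∈S (λ ()) (InS-elim (const 5∣n) (const 7∣n) (contradiction refl))
  ... | yes 5∣n | no _    | yes 13∣n =
    at-least-two-in-S ih R 5∈S (λ ()) (InS-elim (const 5∣n) (contradiction refl) (const 13∣n))
  ... | no _    | yes 7∣n | yes 13∣n =
    at-least-two-in-S ih R 7∈S (λ ()) (InS-elim (contradiction refl) (const 7∣n) (const 13∣n))

corollary3p3 : Star → ∀ n → 0 < n → 3 ∣ n → 3 ≤ t n
corollary3p3 star = <-rec (λ n → 0 < n → 3 ∣ n → 3 ≤ t n) step
  where
  step : ∀ n → (∀ {m} → m < n → 0 < m → 3 ∣ m → 3 ≤ t m) → 0 < n → 3 ∣ n → 3 ≤ t n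
  step n ih 0<n 3∣n with reduced-or-redundant-factor 0<n 3∣n
  ... | inj₁ R = reduced⇒3≤t star R
  ... | inj₂ (r , m , pr , r-redundant , refl) =
    ≤-trans (ih (m<m*prime 0<m pr) 0<m 3∣m) (t-mono 0<n (m∣m*n r) (odd-prime∣quotient pr r-redundant))
    where
    0<m : 0 < m
    0<m = 0<m*n⇒0<m 0<n
    3∣m : 3 ∣ m
    3∣m = odd-prime∣quotient pr r-redundant prime[3] (from-no (2 ∣? 3)) 3∣n
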